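{- Let $n\ge 1$ and $m\ge 1$ be integers, and let $P_m(w)$ denote the probability that a shelf shuffle with $m$ shelves of a deck of $n$ cards produces the permutation $w\in S_n$. Then for every $w\in S_n$, \[ P_m(w)=\frac{4^{v(w)+1}}{2(2m)^n}\sum_{a=0}^{m-1}\binom{n+m-a-1}{n}\binom{n-1-2v(w)}{a-v(w)}, \] where $v(w)$ is the number of valleys of $w$. Equivalently, $P_m(w)$ is the coefficient of $t^m$ in the power series \[ \frac{1}{2(2m)^n}\,\frac{(1+t)^{n+1}}{(1-t)^{n+1}}\left(\frac{4t}{(1+t)^2}\right)^{v(w)+1}. \]
   Context: Shelf shuffle with $m$ shelves of a deck of $n$ cards, initially in order $1,2,\dots,n$ from top to bottom: each card independently receives a label chosen uniformly at random from $\{1,2,\dots,2m\}$. The new deck is formed by placing, from top to bottom, first the cards labeled $1$ in increasing order, then the cards labeled $2$ in decreasing order, then the cards labeled $3$ in increasing order, and so on: the packet of cards with label $j$ is in increasing order if $j$ is odd and in decreasing order if $j$ is even (empty packets are allowed and still count in this alternation). The outcome is recorded as the permutation $w\in S_n$ where $w(i)$ is the card in position $i$ from the top. A valley of $w\in S_n$ is an index $i$ with $1<i<n$ and $w(i-1)>w(i)<w(i+1)$. Binomial coefficients $\binom{k}{j}$ are taken to be $0$ unless $0\le j\le k$. -}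

module Defs where

open import Data.Nat using (ℕ; zero; suc; _+_; _*_; _∸_; _<ᵇ_)
open import Data.Nat.Combinatorics using (_C_)
open import Data.Nat.Base using (_%_)
open import Data.Integer using (ℤ; +_; -[1+_])
open import Data.Bool using (Bool; true; false; if_then_else_; _∧_)
open import Data.Fin using (Fin; toℕ; _≟_)
open import Data.Fin.Permutation using (Permutation′; _⟨$⟩ʳ_)
open import Data.List using (List; []; _∷_; map; filter; reverse; concatMap; length; allFin; tabulate)
open import Data.List.Properties using (≡-dec)
open import Data.Vec using (Vec; lookup) renaming ([] to []ᵥ; _∷_ to _∷ᵥ_)

-- Binomial coefficient with integer arguments: 0 unless 0 ≤ j ≤ k.
binomℤ : ℤ → ℤ → ℕ
binomℤ (+ k) (+ j) = k C j
binomℤ (+ k) -[1+ _ ] = 0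
binomℤ -[1+ _ ] _ = 0

-- All label vectors: a labeling assigns to card i (0-indexed) the label lookup f i.
allVecs : (k n : ℕ) → List (Vec (Fin k) n)
allVecs k zero = []ᵥ ∷ []
allVecs k (suc n) = concatMap (λ x → map (x ∷ᵥ_) (allVecs k n)) (allFin k)

-- Cards carrying label j, in increasing order (cards are 0..n-1 = 1..n shifted).
packet : {k n : ℕ} → Vec (Fin k) n → Fin k → List (Fin n)
packet f j = filter (λ i → lookup f i ≟ j) (allFin _)

-- Labels 0..2m-1 here correspond to labels 1..2m of the paper: 0-indexed label j
-- even (paper label odd) gives increasing packet, otherwise decreasing.
shelfDeck : (m n : ℕ) → Vec (Fin (2 * m)) n → List (Fin n)
shelfDeck m n f =
  concatMap (λ j → if toℕ j % 2 Data.Nat.≡ᵇ 0 then packet f j else reverse (packet f j))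
            (allFin (2 * m))
  where import Data.Nat

-- The permutation w written as the list w(1), ..., w(n) (top to bottom).
permList : {n : ℕ} → Permutation′ n → List (Fin n)
permList w = tabulate (w ⟨$⟩ʳ_)

-- Number of labelings (out of (2m)^n equally likely) whose shuffle yields w.
-- Thus P_m(w) = shelfCount m n w / (2m)^n.
shelfCount : (m n : ℕ) → Permutation′ n → ℕ
shelfCount m n w =
  length (filter (λ f → ≡-dec _≟_ (shelfDeck m n f) (permList w)) (allVecs (2 * m) n))

valleysList : List ℕ → ℕ
valleysList (a ∷ b ∷ c ∷ rest) =
  (if (b <ᵇ a) ∧ (b <ᵇ c) then 1 else 0) + valleysList (b ∷ c ∷ rest)
valleysList _ = 0

valleys : {n : ℕ} → Permutation′ n → ℕ
valleys w = valleysList (map toℕ (permList w))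

module Submission where

-- Strategy. (1) Power series over ℕ are coefficient sequences; multiplication by t, 1+t and
-- 1/(1-t) are operators on them, and their algebra yields the coefficients of
-- t^v (1+t)^e / (1-t)^n as a sum of products of binomial coefficients.
-- (2) A transfer count 'extensions p j' over the up/down pattern p obeys a recurrence which,
-- after pairing the labels 2r, 2r+1 (one shelf), multiplies the generating series by
-- (1+t)/(1-t) at every free step and by 4t/(1-t)^2 at every valley; hence its total is
-- 2·4^v times the coefficient of t^(m-1) in t^v (1+t)^e/(1-t)^(n+1) ('totalExtensions').
-- (3) The shuffled deck is the list of cards sorted by (label, packet order), so a labeling
-- yields w exactly when the labels read along w are consistent with that order; relabeling
-- along w and a transfer-matrix recursion over positions identify the count with the
-- transfer count of w's up/down pattern ('shelfCount-extensions').
-- (4) Translating the integer-argument binomials of the statement gives the theorem.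

open import Data.Nat
open import Data.Nat.Properties
open import Data.Nat.Combinatorics using (_C_; nCk+nC[k+1]≡[n+1]C[k+1]; nCn≡1)
open import Data.Nat.GeneralisedArithmetic using (fold)
open import Data.Nat.DivMod using ([m+n]%n≡m%n)
open import Data.Nat.ListAction using (sum)
open import Data.Nat.ListAction.Properties using (sum-++; sum-↭)
open import Data.Nat.Solver using (module +-*-Solver)
open import Data.Bool using (Bool; true; false; if_then_else_; not; _∧_; _∨_; T)
open import Data.Bool.Properties using (T-∧)
open import Data.Empty using (⊥; ⊥-elim)
open import Data.Unit using (tt)
open import Data.Product using (_×_; _,_; proj₁; proj₂)
open import Data.Sum using (_⊎_; inj₁; inj₂)
open import Data.Fin using (Fin; toℕ) renaming (zero to fzero; suc to fsuc)
import Data.Fin.Properties as Fin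
open import Data.Fin.Permutation using (Permutation′; _⟨$⟩ʳ_; _⟨$⟩ˡ_; inverseʳ; inverseˡ)
open import Data.Vec using (Vec; lookup) renaming ([] to []ᵥ; _∷_ to _∷ᵥ_)
import Data.Vec as Vec
import Data.Vec.Properties as Vecₚ
open import Data.List
  using (List; []; _∷_; length; map; concatMap; _++_; allFin; tabulate; filter; reverse; cartesianProductWith; upTo; applyUpTo)
open import Data.List.Properties
  using (map-++; map-∘; map-cong; unfold-reverse; length-map; length-tabulate; ≡-dec)
open import Data.List.Membership.Propositional using (_∈_; lose)
open import Data.List.Membership.Propositional.Properties
  using (∈-filter⁺; ∈-filter⁻; ∈-allFin; ∈-concatMap⁺; ∈-map⁺; ∈-cartesianProductWith⁺; ∈-tabulate⁺)
open import Data.List.Membership.Propositional.Properties.WithK using (unique∧set⇒bag)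
open import Data.List.Relation.Unary.All as All using (All; []; _∷_)
import Data.List.Relation.Unary.All.Properties as Allₚ
open import Data.List.Relation.Unary.AllPairs using (AllPairs; []; _∷_)
import Data.List.Relation.Unary.AllPairs as AllPairs
import Data.List.Relation.Unary.AllPairs.Properties as AllPairsₚ
open import Data.List.Relation.Unary.Any using (here; there)
import Data.List.Relation.Unary.Any.Properties as Anyₚ
open import Data.List.Relation.Unary.Linked using (Linked; []; [-]; _∷_)
import Data.List.Relation.Unary.Linked.Properties as Linkedₚ
open import Data.List.Relation.Unary.Unique.Propositional using (Unique)
import Data.List.Relation.Unary.Unique.Propositional.Properties as Uniqueₚ
open import Data.List.Relation.Binary.Permutation.Propositional using (_↭_)
import Data.List.Relation.Binary.Permutation.Propositional.Properties as Perm
open import Data.List.Relation.Binary.BagAndSetEquality using (∼bag⇒↭)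
open import Function using (_∘_)
open import Function.Bundles using (Equivalence; mk⇔)
open import Relation.Nullary using (Dec; does; yes; no)
open import Relation.Binary.Definitions using (tri<; tri≈; tri>)
open import Relation.Binary.PropositionalEquality
import Relation.Binary.Reasoning.Setoid as SetoidReasoning
open import Defs using (allVecs; packet; shelfDeck; shelfCount; permList; valleysList; valleys; binomℤ)

open +-*-Solver using (solve; _:+_; _:*_; _:=_; con)

-- Coefficient sequences of formal power series in t over ℕ; equality is pointwise.
Seq : Set
Seq = ℕ → ℕ

module ≗-Reasoning = SetoidReasoning (ℕ →-setoid ℕ)

≗-refl : {s : Seq} → s ≗ s
≗-refl r = refl

≗-sym : {s t : Seq} → s ≗ t → t ≗ s
≗-sym s≗t r = sym (s≗t r)

≗-trans : {s t u : Seq} → s ≗ t → t ≗ u → s ≗ u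
≗-trans s≗t t≗u r = trans (s≗t r) (t≗u r)

one : Seq
one zero    = 1
one (suc _) = 0

mulT : Seq → Seq
mulT s zero    = 0
mulT s (suc r) = s r

-- Multiplication by 1/(1-t), i.e. partial sums.
cumsum : Seq → Seq
cumsum s zero    = s 0
cumsum s (suc r) = cumsum s r + s (suc r)

mulOnePlusT : Seq → Seq
mulOnePlusT s r = s r + mulT s r

scale : ℕ → Seq → Seq
scale c s r = c * s r

infixl 6 _⊕_
_⊕_ : Seq → Seq → Seq
(s ⊕ t) r = s r + t r

_^[_] : (Seq → Seq) → ℕ → Seq → Seq
(F ^[ k ]) s = fold s F k

Congruent : (Seq → Seq) → Set
Congruent F = ∀ {s t} → s ≗ t → F s ≗ F t

mulT-cong : Congruent mulT
mulT-cong s≗t zero    = refl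
mulT-cong s≗t (suc r) = s≗t r

cumsum-cong : Congruent cumsum
cumsum-cong s≗t zero    = s≗t 0
cumsum-cong s≗t (suc r) = cong₂ _+_ (cumsum-cong s≗t r) (s≗t (suc r))

mulOnePlusT-cong : Congruent mulOnePlusT
mulOnePlusT-cong s≗t r = cong₂ _+_ (s≗t r) (mulT-cong s≗t r)

scale-cong : ∀ c → Congruent (scale c)
scale-cong c s≗t r = cong (c *_) (s≗t r)

^-cong : ∀ {F : Seq → Seq} → Congruent F → ∀ k → Congruent (F ^[ k ])
^-cong F-cong zero    s≗t = s≗t
^-cong F-cong (suc k) s≗t = F-cong (^-cong F-cong k s≗t)

^-comm : ∀ {F G : Seq → Seq} → Congruent F → (∀ s → G (F s) ≗ F (G s)) →
         ∀ k s → G ((F ^[ k ]) s) ≗ (F ^[ k ]) (G s)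
^-comm F-cong comm zero    s = ≗-refl
^-comm {F} {G} F-cong comm (suc k) s =
  ≗-trans (comm ((F ^[ k ]) s)) (F-cong (^-comm {F} {G} F-cong comm k s))

cumsum-unfold : ∀ s → cumsum s ≗ s ⊕ mulT (cumsum s)
cumsum-unfold s zero    = sym (+-identityʳ (s 0))
cumsum-unfold s (suc r) = +-comm (cumsum s r) (s (suc r))

-- The operators are linear and pairwise commute, being multiplications by power series.
cumsum-⊕ : ∀ s t → cumsum (s ⊕ t) ≗ cumsum s ⊕ cumsum t
cumsum-⊕ s t zero    = refl
cumsum-⊕ s t (suc r) = begin
  cumsum (s ⊕ t) r + (s (suc r) + t (suc r))         ≡⟨ cong (_+ (s (suc r) + t (suc r))) (cumsum-⊕ s t r) ⟩
  (cumsum s r + cumsum t r) + (s (suc r) + t (suc r)) 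
    ≡⟨ solve 4 (λ a b c d → (a :+ b) :+ (c :+ d) := (a :+ c) :+ (b :+ d)) refl (cumsum s r) (cumsum t r) _ _ ⟩
  (cumsum s r + s (suc r)) + (cumsum t r + t (suc r)) ∎
  where open ≡-Reasoning

cumsum-scale : ∀ c s → cumsum (scale c s) ≗ scale c (cumsum s)
cumsum-scale c s zero    = refl
cumsum-scale c s (suc r) =
  trans (cong (_+ c * s (suc r)) (cumsum-scale c s r)) (sym (*-distribˡ-+ c (cumsum s r) (s (suc r))))

mulT-scale : ∀ c s → mulT (scale c s) ≗ scale c (mulT s)
mulT-scale c s zero    = sym (*-zeroʳ c)
mulT-scale c s (suc r) = refl

mulOnePlusT-scale : ∀ c s → mulOnePlusT (scale c s) ≗ scale c (mulOnePlusT s)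
mulOnePlusT-scale c s r =
  trans (cong (c * s r +_) (mulT-scale c s r)) (sym (*-distribˡ-+ c (s r) (mulT s r)))

scale-scale : ∀ a b s → scale a (scale b s) ≗ scale (a * b) s
scale-scale a b s r = sym (*-assoc a b (s r))

cumsum-mulT : ∀ s → cumsum (mulT s) ≗ mulT (cumsum s)
cumsum-mulT s zero          = refl
cumsum-mulT s (suc zero)    = refl
cumsum-mulT s (suc (suc r)) = cong (_+ s (suc r)) (cumsum-mulT s (suc r))

cumsum-mulOnePlusT : ∀ s → cumsum (mulOnePlusT s) ≗ mulOnePlusT (cumsum s)
cumsum-mulOnePlusT s r = trans (cumsum-⊕ s (mulT s) r) (cong (cumsum s r +_) (cumsum-mulT s r))

mulOnePlusT-mulT : ∀ s → mulOnePlusT (mulT s) ≗ mulT (mulOnePlusT s)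
mulOnePlusT-mulT s zero    = refl
mulOnePlusT-mulT s (suc r) = refl

sumˡ : ℕ → (ℕ → ℕ) → ℕ
sumˡ zero    f = 0
sumˡ (suc k) f = f 0 + sumˡ k (f ∘ suc)

sumʳ : ℕ → (ℕ → ℕ) → ℕ
sumʳ zero    f = 0
sumʳ (suc k) f = sumʳ k f + f k

sumˡ-cong : ∀ k {f g} → (∀ a → a < k → f a ≡ g a) → sumˡ k f ≡ sumˡ k g
sumˡ-cong zero    f≡g = refl
sumˡ-cong (suc k) f≡g = cong₂ _+_ (f≡g 0 z<s) (sumˡ-cong k (λ a a<k → f≡g (suc a) (s<s a<k)))

sumˡ-⊕ : ∀ k f g → sumˡ k (λ a → f a + g a) ≡ sumˡ k f + sumˡ k g
sumˡ-⊕ zero    f g = refl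
sumˡ-⊕ (suc k) f g = trans (cong (f 0 + g 0 +_) (sumˡ-⊕ k (f ∘ suc) (g ∘ suc)))
  (solve 4 (λ a b c d → (a :+ b) :+ (c :+ d) := (a :+ c) :+ (b :+ d)) refl (f 0) (g 0) _ _)

sumˡ-zero : ∀ k → sumˡ k (λ _ → 0) ≡ 0
sumˡ-zero zero    = refl
sumˡ-zero (suc k) = sumˡ-zero k

conv : Seq → Seq → Seq
conv c g k = sumˡ (suc k) (λ a → c a * g (k ∸ a))

conv-one : ∀ g → conv one g ≗ g
conv-one g k = trans (cong (g k + 0 +_) (sumˡ-zero k)) (trans (+-identityʳ _) (+-identityʳ _))

conv-mulT : ∀ c g → conv (mulT c) g ≗ mulT (conv c g)
conv-mulT c g zero    = refl
conv-mulT c g (suc k) = refl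

conv-⊕ : ∀ c d g → conv (c ⊕ d) g ≗ conv c g ⊕ conv d g
conv-⊕ c d g k = trans (sumˡ-cong (suc k) (λ a _ → *-distribʳ-+ (g (k ∸ a)) (c a) (d a)))
  (sumˡ-⊕ (suc k) (λ a → c a * g (k ∸ a)) (λ a → d a * g (k ∸ a)))

conv-mulOnePlusT : ∀ c g → conv (mulOnePlusT c) g ≗ mulOnePlusT (conv c g)
conv-mulOnePlusT c g k = trans (conv-⊕ c (mulT c) g k) (cong (conv c g k +_) (conv-mulT c g k))

binomial : ∀ e a → (mulOnePlusT ^[ e ]) one a ≡ e C a
binomial zero    zero    = refl
binomial zero    (suc a) = refl
binomial (suc e) zero    = cong (_+ 0) (binomial e zero)
binomial (suc e) (suc a) = begin
  (mulOnePlusT ^[ e ]) one (suc a) + (mulOnePlusT ^[ e ]) one a ≡⟨ cong₂ _+_ (binomial e (suc a)) (binomial e a) ⟩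
  e C suc a + e C a                                           ≡⟨ +-comm (e C suc a) (e C a) ⟩
  e C a + e C suc a                                           ≡⟨ nCk+nC[k+1]≡[n+1]C[k+1] e a ⟩
  suc e C suc a                                               ∎
  where open ≡-Reasoning

cumsum-one : ∀ r → cumsum one r ≡ 1
cumsum-one zero    = refl
cumsum-one (suc r) = trans (+-identityʳ _) (cumsum-one r)

negativeBinomial : ∀ n k → (cumsum ^[ suc n ]) one k ≡ (k + n) C n
negativeBinomial zero    k       = cumsum-one k
negativeBinomial (suc n) zero    = trans (negativeBinomial n 0) (trans (nCn≡1 n) (sym (nCn≡1 (suc n))))
negativeBinomial (suc n) (suc k) = begin
  (cumsum ^[ suc (suc n) ]) one k + (cumsum ^[ suc n ]) one (suc k)
    ≡⟨ cong₂ _+_ (negativeBinomial (suc n) k) (negativeBinomial n (suc k)) ⟩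
  (k + suc n) C suc n + (suc k + n) C n ≡⟨ cong (λ z → z C suc n + (suc k + n) C n) (+-suc k n) ⟩
  (suc k + n) C suc n + (suc k + n) C n ≡⟨ +-comm ((suc k + n) C suc n) _ ⟩
  (suc k + n) C n + (suc k + n) C suc n ≡⟨ nCk+nC[k+1]≡[n+1]C[k+1] (suc k + n) n ⟩
  suc (suc k + n) C suc n               ≡⟨ cong (λ z → suc z C suc n) (sym (+-suc k n)) ⟩
  (suc k + suc n) C suc n               ∎
  where open ≡-Reasoning

mulT^-coefficient : ∀ v c a → (mulT ^[ v ]) c a ≡ (if a <ᵇ v then 0 else c (a ∸ v))
mulT^-coefficient zero    c a       = refl
mulT^-coefficient (suc v) c zero    = refl
mulT^-coefficient (suc v) c (suc a) = mulT^-coefficient v c a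

series : ℕ → ℕ → ℕ → Seq
series v e n = (mulT ^[ v ]) ((mulOnePlusT ^[ e ]) ((cumsum ^[ n ]) one))

series-conv : ∀ v e n → series v e n ≗ conv ((mulT ^[ v ]) ((mulOnePlusT ^[ e ]) one)) ((cumsum ^[ n ]) one)
series-conv v e n = begin
  series v e n                                 ≈⟨ ^-cong mulT-cong v (^-cong mulOnePlusT-cong e (≗-sym (conv-one g))) ⟩
  (mulT ^[ v ]) ((mulOnePlusT ^[ e ]) (conv one g))
    ≈⟨ ^-cong mulT-cong v (≗-sym (^-comm mulOnePlusT-cong (λ c → conv-mulOnePlusT c g) e one)) ⟩
  (mulT ^[ v ]) (conv ((mulOnePlusT ^[ e ]) one) g)
    ≈⟨ ≗-sym (^-comm mulT-cong (λ c → conv-mulT c g) v _) ⟩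
  conv ((mulT ^[ v ]) ((mulOnePlusT ^[ e ]) one)) g ∎
  where
    open ≗-Reasoning
    g = (cumsum ^[ n ]) one

cumsum-series : ∀ v e n → cumsum (series v e n) ≗ series v e (suc n)
cumsum-series v e n = ≗-trans (^-comm mulT-cong cumsum-mulT v _)
  (^-cong mulT-cong v (^-comm mulOnePlusT-cong cumsum-mulOnePlusT e _))

mulOnePlusT-series : ∀ v e n → mulOnePlusT (series v e n) ≗ series v (suc e) n
mulOnePlusT-series v e n = ^-comm mulT-cong mulOnePlusT-mulT v _

-- Up/down patterns: true records an ascent, false a descent.
-- A valley is a descent immediately followed by an ascent.
valleysOf : List Bool → ℕ
valleysOf []                   = 0
valleysOf (true ∷ p)           = valleysOf p
valleysOf (false ∷ [])         = 0
valleysOf (false ∷ true ∷ p)   = suc (valleysOf p)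
valleysOf (false ∷ false ∷ p)  = valleysOf (false ∷ p)

-- The steps of a pattern that do not belong to a valley.
freeSteps : List Bool → ℕ
freeSteps []                  = 0
freeSteps (true ∷ p)          = suc (freeSteps p)
freeSteps (false ∷ [])        = 1
freeSteps (false ∷ true ∷ p)  = freeSteps p
freeSteps (false ∷ false ∷ p) = suc (freeSteps (false ∷ p))

length-pattern : ∀ p → length p ≡ freeSteps p + 2 * valleysOf p
length-pattern []                  = refl
length-pattern (true ∷ p)          = cong suc (length-pattern p)
length-pattern (false ∷ [])        = refl
length-pattern (false ∷ true ∷ p)  = trans (cong (suc ∘ suc) (length-pattern p))
  (solve 2 (λ e v → con 2 :+ (e :+ con 2 :* v) := e :+ con 2 :* (con 1 :+ v)) refl (freeSteps p) (valleysOf p))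
length-pattern (false ∷ false ∷ p) = cong suc (length-pattern (false ∷ p))

isEven : ℕ → Bool
isEven zero          = true
isEven (suc zero)    = false
isEven (suc (suc n)) = isEven n

double : ℕ → ℕ
double zero    = zero
double (suc r) = suc (suc (double r))

isEven-double : ∀ r → isEven (double r) ≡ true
isEven-double zero    = refl
isEven-double (suc r) = isEven-double r

isEven-suc-double : ∀ r → isEven (suc (double r)) ≡ false
isEven-suc-double zero    = refl
isEven-suc-double (suc r) = isEven-suc-double r

-- Among 2m labels (0-based), the label with j labels above it has the parity opposite to j.
-- Two consecutive cards may share that label exactly when they follow its packet direction:
-- a descent (decreasing packet) when j is even, an ascent (increasing packet) when j is odd.
sameLabelAllowed : Bool → ℕ → Bool
sameLabelAllowed ascent j = if isEven j then not ascent else ascent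

-- extensions p j: the number of ways to label the positions after the first of a sequence
-- with up/down pattern p consistently with the deck order, when the first position carries
-- the label with exactly j labels above it (proved in 'consistent-extensions').
extensions : List Bool → ℕ → ℕ
extensions []       j = 1
extensions (b ∷ p)  j = sumʳ j (extensions p) + (if sameLabelAllowed b j then extensions p j else 0)

-- Grouping the labels into pairs (one pair per shelf): the counts at 2r and 2r+1 labels
-- above, jointly and for the even member alone.
extPair : List Bool → Seq
extPair p r = extensions p (double r) + extensions p (suc (double r))

extEven : List Bool → Seq
extEven p r = extensions p (double r)

sumʳ-extensions : ∀ p r → sumʳ (double r) (extensions p) ≡ mulT (cumsum (extPair p)) r
sumʳ-extensions p zero    = refl
sumʳ-extensions p (suc r) = begin
  (sumʳ (double r) (extensions p) + extEven p r) + extensions p (suc (double r))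
    ≡⟨ +-assoc (sumʳ (double r) (extensions p)) _ _ ⟩
  sumʳ (double r) (extensions p) + extPair p r ≡⟨ cong (_+ extPair p r) (sumʳ-extensions p r) ⟩
  mulT (cumsum (extPair p)) r + extPair p r     ≡⟨ +-comm (mulT (cumsum (extPair p)) r) (extPair p r) ⟩
  extPair p r + mulT (cumsum (extPair p)) r     ≡⟨ sym (cumsum-unfold (extPair p) r) ⟩
  cumsum (extPair p) r                          ∎
  where open ≡-Reasoning

module _ (p : List Bool) (r : ℕ) where
  private
    below : ℕ
    below = mulT (cumsum (extPair p)) r

  extensions-up-even : extensions (true ∷ p) (double r) ≡ below
  extensions-up-even rewrite isEven-double r = trans (+-identityʳ _) (sumʳ-extensions p r)

  extensions-up-odd : extensions (true ∷ p) (suc (double r)) ≡ (below + extEven p r) + extensions p (suc (double r))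
  extensions-up-odd rewrite isEven-suc-double r =
    cong (λ z → z + extEven p r + extensions p (suc (double r))) (sumʳ-extensions p r)

  extensions-down-even : extensions (false ∷ p) (double r) ≡ below + extEven p r
  extensions-down-even rewrite isEven-double r = cong (_+ extEven p r) (sumʳ-extensions p r)

  extensions-down-odd : extensions (false ∷ p) (suc (double r)) ≡ below + extEven p r
  extensions-down-odd rewrite isEven-suc-double r =
    trans (+-identityʳ _) (cong (_+ extEven p r) (sumʳ-extensions p r))

extPair-up : ∀ p → extPair (true ∷ p) ≗ mulOnePlusT (cumsum (extPair p))
extPair-up p r = begin
  extensions (true ∷ p) (double r) + extensions (true ∷ p) (suc (double r))
    ≡⟨ cong₂ _+_ (extensions-up-even p r) (extensions-up-odd p r) ⟩
  X + ((X + extEven p r) + extensions p (suc (double r)))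
    ≡⟨ solve 3 (λ x a b → x :+ ((x :+ a) :+ b) := ((a :+ b) :+ x) :+ x) refl X (extEven p r) _ ⟩
  (extPair p r + X) + X ≡⟨ cong (_+ X) (sym (cumsum-unfold (extPair p) r)) ⟩
  mulOnePlusT (cumsum (extPair p)) r ∎
  where
    open ≡-Reasoning
    X = mulT (cumsum (extPair p)) r

extPair-down : ∀ p r → extPair (false ∷ p) r ≡ extEven (false ∷ p) r + extEven (false ∷ p) r
extPair-down p r = cong (extEven (false ∷ p) r +_) (trans (extensions-down-odd p r) (sym (extensions-down-even p r)))

-- A descent not followed by an ascent also multiplies by (1+t)/(1-t), provided the
-- paired sequence of the rest is twice its even part (true for [] and after a descent).
extPair-down-free : ∀ p → (∀ r → extEven p r + extEven p r ≡ extPair p r) →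
                    extPair (false ∷ p) ≗ mulOnePlusT (cumsum (extPair p))
extPair-down-free p balanced r = begin
  extPair (false ∷ p) r ≡⟨ extPair-down p r ⟩
  extEven (false ∷ p) r + extEven (false ∷ p) r ≡⟨ cong (λ z → z + z) (extensions-down-even p r) ⟩
  (X + extEven p r) + (X + extEven p r)
    ≡⟨ solve 2 (λ x a → (x :+ a) :+ (x :+ a) := ((a :+ a) :+ x) :+ x) refl X (extEven p r) ⟩
  ((extEven p r + extEven p r) + X) + X ≡⟨ cong (λ z → (z + X) + X) (balanced r) ⟩
  (extPair p r + X) + X ≡⟨ cong (_+ X) (sym (cumsum-unfold (extPair p) r)) ⟩
  mulOnePlusT (cumsum (extPair p)) r ∎
  where
    open ≡-Reasoning
    X = mulT (cumsum (extPair p)) r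

mulOnePlusT-cumsum : ∀ h → mulOnePlusT (cumsum h) ⊕ h ≗ scale 2 (cumsum h)
mulOnePlusT-cumsum h r = begin
  (cumsum h r + mulT (cumsum h) r) + h r ≡⟨ cong (λ z → (z + mulT (cumsum h) r) + h r) (cumsum-unfold h r) ⟩
  ((h r + X) + X) + h r ≡⟨ solve 2 (λ a x → ((a :+ x) :+ x) :+ a := con 2 :* (a :+ x)) refl (h r) X ⟩
  2 * (h r + X) ≡⟨ cong (2 *_) (sym (cumsum-unfold h r)) ⟩
  2 * cumsum h r ∎
  where
    open ≡-Reasoning
    X = mulT (cumsum h) r

extPair-valley : ∀ p → extPair (false ∷ true ∷ p) ≗ scale 4 (mulT (cumsum (cumsum (extPair p))))
extPair-valley p r = begin
  extPair (false ∷ true ∷ p) r ≡⟨ extPair-down (true ∷ p) r ⟩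
  Y + Y ≡⟨ cong (λ z → z + z) (trans (extensions-down-even (true ∷ p) r) (cong (X′ +_) (extensions-up-even p r))) ⟩
  (X′ + X) + (X′ + X) ≡⟨ cong (λ z → z + z) (halves r) ⟩
  2 * Z + 2 * Z ≡⟨ solve 1 (λ z → con 2 :* z :+ con 2 :* z := con 4 :* z) refl Z ⟩
  4 * Z ∎
  where
    open ≡-Reasoning
    h = extPair p
    Y = extEven (false ∷ true ∷ p) r
    X = mulT (cumsum h) r
    X′ = mulT (cumsum (extPair (true ∷ p))) r
    Z = mulT (cumsum (cumsum h)) r
    twice : cumsum (extPair (true ∷ p)) ⊕ cumsum h ≗ scale 2 (cumsum (cumsum h))
    twice = ≗-trans (≗-sym (cumsum-⊕ (extPair (true ∷ p)) h)) (≗-trans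
      (cumsum-cong (λ q → cong (_+ h q) (extPair-up p q)))
      (≗-trans (cumsum-cong (mulOnePlusT-cumsum h)) (cumsum-scale 2 (cumsum h))))
    halves : ∀ q → mulT (cumsum (extPair (true ∷ p))) q + mulT (cumsum h) q ≡ 2 * mulT (cumsum (cumsum h)) q
    halves zero    = refl
    halves (suc q) = twice q

step-free : ∀ c v e n {h} → h ≗ scale c (series v e n) →
            mulOnePlusT (cumsum h) ≗ scale c (series v (suc e) (suc n))
step-free c v e n {h} h≗ = begin
  mulOnePlusT (cumsum h)                       ≈⟨ mulOnePlusT-cong (cumsum-cong h≗) ⟩
  mulOnePlusT (cumsum (scale c (series v e n))) ≈⟨ mulOnePlusT-cong (cumsum-scale c _) ⟩
  mulOnePlusT (scale c (cumsum (series v e n))) ≈⟨ mulOnePlusT-scale c _ ⟩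
  scale c (mulOnePlusT (cumsum (series v e n))) ≈⟨ scale-cong c (mulOnePlusT-cong (cumsum-series v e n)) ⟩
  scale c (mulOnePlusT (series v e (suc n)))   ≈⟨ scale-cong c (mulOnePlusT-series v e (suc n)) ⟩
  scale c (series v (suc e) (suc n))           ∎
  where open ≗-Reasoning

step-valley : ∀ c v e n {h} → h ≗ scale c (series v e n) →
              scale 4 (mulT (cumsum (cumsum h))) ≗ scale (4 * c) (series (suc v) e (suc (suc n)))
step-valley c v e n {h} h≗ = begin
  scale 4 (mulT (cumsum (cumsum h)))                        ≈⟨ scale-cong 4 (mulT-cong (cumsum-cong (cumsum-cong h≗))) ⟩
  scale 4 (mulT (cumsum (cumsum (scale c (series v e n))))) ≈⟨ scale-cong 4 (mulT-cong (cumsum-cong (cumsum-scale c _))) ⟩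
  scale 4 (mulT (cumsum (scale c (cumsum (series v e n))))) ≈⟨ scale-cong 4 (mulT-cong (cumsum-scale c _)) ⟩
  scale 4 (mulT (scale c (cumsum (cumsum (series v e n))))) ≈⟨ scale-cong 4 (mulT-scale c _) ⟩
  scale 4 (scale c (mulT (cumsum (cumsum (series v e n))))) ≈⟨ scale-scale 4 c _ ⟩
  scale (4 * c) (mulT (cumsum (cumsum (series v e n))))     ≈⟨ scale-cong (4 * c) (mulT-cong (cumsum-cong (cumsum-series v e n))) ⟩
  scale (4 * c) (mulT (cumsum (series v e (suc n))))       ≈⟨ scale-cong (4 * c) (mulT-cong (cumsum-series v e (suc n))) ⟩
  scale (4 * c) (series (suc v) e (suc (suc n)))          ∎
  where open ≗-Reasoning

extPair-closed : ∀ p → extPair p ≗ scale (2 * 4 ^ valleysOf p) (series (valleysOf p) (freeSteps p) (suc (length p)))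
extPair-closed []                  r = sym (cong (2 *_) (cumsum-one r))
extPair-closed (true ∷ p)          =
  ≗-trans (extPair-up p) (step-free (2 * 4 ^ valleysOf p) (valleysOf p) (freeSteps p) (suc (length p)) (extPair-closed p))
extPair-closed (false ∷ [])        =
  ≗-trans (extPair-down-free [] (λ r → refl)) (step-free 2 0 0 1 (extPair-closed []))
extPair-closed (false ∷ false ∷ p) =
  ≗-trans (extPair-down-free (false ∷ p) (λ r → sym (extPair-down p r)))
          (step-free (2 * 4 ^ valleysOf (false ∷ p)) (valleysOf (false ∷ p)) (freeSteps (false ∷ p)) (2 + length p)
                     (extPair-closed (false ∷ p)))
extPair-closed (false ∷ true ∷ p)  = begin
  extPair (false ∷ true ∷ p)
    ≈⟨ extPair-valley p ⟩
  scale 4 (mulT (cumsum (cumsum (extPair p))))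
    ≈⟨ step-valley (2 * 4 ^ v) v (freeSteps p) (suc (length p)) (extPair-closed p) ⟩
  scale (4 * (2 * 4 ^ v)) S
    ≈⟨ (λ r → cong (_* S r) (solve 1 (λ x → con 4 :* (con 2 :* x) := con 2 :* (con 4 :* x)) refl (4 ^ v))) ⟩
  scale (2 * 4 ^ suc v) S ∎
  where
    open ≗-Reasoning
    v = valleysOf p
    S = series (suc v) (freeSteps p) (3 + length p)


totalExtensions : ∀ p m' → let v = valleysOf p; e = freeSteps p; N = suc (length p) in
  sumʳ (double (suc m')) (extensions p)
    ≡ 2 * 4 ^ v * sumˡ (suc m') (λ a → (((m' ∸ a) + N) C N) * (if a <ᵇ v then 0 else e C (a ∸ v)))
totalExtensions p m' = begin
  sumʳ (double (suc m')) (extensions p)  ≡⟨ sumʳ-extensions p (suc m') ⟩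
  cumsum (extPair p) m'                  ≡⟨ cumsum-cong (extPair-closed p) m' ⟩
  cumsum (scale c (series v e N)) m'     ≡⟨ cumsum-scale c (series v e N) m' ⟩
  c * cumsum (series v e N) m'           ≡⟨ cong (c *_) (≗-trans (cumsum-series v e N) (series-conv v e (suc N)) m') ⟩
  c * conv shifted ((cumsum ^[ suc N ]) one) m'
    ≡⟨ cong (c *_) (sumˡ-cong (suc m') (λ a _ → coefficient a)) ⟩
  c * sumˡ (suc m') (λ a → (((m' ∸ a) + N) C N) * (if a <ᵇ v then 0 else e C (a ∸ v))) ∎
  where
    open ≡-Reasoning
    v = valleysOf p
    e = freeSteps p
    N = suc (length p)
    c = 2 * 4 ^ v
    shifted = (mulT ^[ v ]) ((mulOnePlusT ^[ e ]) one)
    coefficient : ∀ a → shifted a * (cumsum ^[ suc N ]) one (m' ∸ a)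
                        ≡ (((m' ∸ a) + N) C N) * (if a <ᵇ v then 0 else e C (a ∸ v))
    coefficient a = trans (*-comm (shifted a) _)
      (cong₂ _*_ (negativeBinomial N (m' ∸ a)) (trans (mulT^-coefficient v ((mulOnePlusT ^[ e ]) one) a)
        (cong (λ z → if a <ᵇ v then 0 else z) (binomial e (a ∸ v)))))

count : {A : Set} → (A → Bool) → List A → ℕ
count q xs = sum (map (λ x → if q x then 1 else 0) xs)

count-++ : {A : Set} (q : A → Bool) (xs ys : List A) → count q (xs ++ ys) ≡ count q xs + count q ys
count-++ q xs ys = trans (cong sum (map-++ _ xs ys)) (sum-++ (map _ xs) _)

count-concatMap : {A B : Set} (q : B → Bool) (h : A → List B) (xs : List A) →
                  count q (concatMap h xs) ≡ sum (map (λ y → count q (h y)) xs)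
count-concatMap q h []       = refl
count-concatMap q h (x ∷ xs) =
  trans (count-++ q (h x) (concatMap h xs)) (cong (count q (h x) +_) (count-concatMap q h xs))

count-map : {A B : Set} (q : B → Bool) (h : A → B) (xs : List A) → count q (map h xs) ≡ count (q ∘ h) xs
count-map q h xs = cong sum (sym (map-∘ xs))

count-cong : {A : Set} {q r : A → Bool} (xs : List A) → (∀ a → q a ≡ r a) → count q xs ≡ count r xs
count-cong []       q≡r = refl
count-cong (x ∷ xs) q≡r = cong₂ (λ b n → (if b then 1 else 0) + n) (q≡r x) (count-cong xs q≡r)

count-guarded : {A : Set} (b : Bool) (r : A → Bool) (xs : List A) →
                count (λ z → b ∧ r z) xs ≡ (if b then count r xs else 0)
count-guarded true  r xs = refl
count-guarded false r xs = lemma xs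
  where
    lemma : ∀ xs → count (λ _ → false) xs ≡ 0
    lemma []       = refl
    lemma (_ ∷ xs) = lemma xs

count-↭ : {A : Set} (q : A → Bool) {xs ys : List A} → xs ↭ ys → count q xs ≡ count q ys
count-↭ q xs↭ys = sum-↭ (Perm.map⁺ _ xs↭ys)

length-filter : {A : Set} {P : A → Set} (P? : ∀ x → Dec (P x)) (xs : List A) →
                length (filter P? xs) ≡ count (λ x → does (P? x)) xs
length-filter P? []       = refl
length-filter P? (x ∷ xs) with does (P? x)
... | true  = cong suc (length-filter P? xs)
... | false = length-filter P? xs

-- The shuffled deck lists (label, card) pairs in this order: smaller labels first, and
-- within the packet of label x (0-based) cards increase if x is even and decrease if odd.
packetOrder : ℕ → ℕ → ℕ → Bool
packetOrder x c c′ = if isEven x then c <ᵇ c′ else c′ <ᵇ c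

placedAbove : ℕ → ℕ → ℕ → ℕ → Bool
placedAbove x c y c′ = (x <ᵇ y) ∨ ((x ≡ᵇ y) ∧ packetOrder x c c′)

consistent : ∀ {M k} → Vec (Fin M) k → List ℕ → Bool
consistent (x ∷ᵥ y ∷ᵥ ls) (c ∷ c′ ∷ cs) = placedAbove (toℕ x) c (toℕ y) c′ ∧ consistent (y ∷ᵥ ls) (c′ ∷ cs)
consistent _ _ = true

updown : List ℕ → List Bool
updown (c ∷ c′ ∷ cs) = (c <ᵇ c′) ∷ updown (c′ ∷ cs)
updown _             = []

T⇒≡true : ∀ {b} → T b → b ≡ true
T⇒≡true {true} _ = refl

¬T⇒≡false : ∀ {b} → (T b → ⊥) → b ≡ false
¬T⇒≡false {true}  ¬t = ⊥-elim (¬t _)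
¬T⇒≡false {false} _  = refl

<ᵇ-flip : ∀ c c′ → c ≢ c′ → (c′ <ᵇ c) ≡ not (c <ᵇ c′)
<ᵇ-flip c c′ c≢c′ with <-cmp c c′
... | tri< c<c′ _ _ = trans (¬T⇒≡false (λ t → <-asym c<c′ (<ᵇ⇒< c′ c t))) (cong not (sym (T⇒≡true (<⇒<ᵇ c<c′))))
... | tri≈ _ c≡c′ _ = ⊥-elim (c≢c′ c≡c′)
... | tri> _ _ c>c′ = trans (T⇒≡true (<⇒<ᵇ c>c′)) (cong not (sym (¬T⇒≡false (λ t → <-asym c>c′ (<ᵇ⇒< c c′ t)))))

isEven-above : ∀ m x → x < double m → isEven (double m ∸ suc x) ≡ not (isEven x)
isEven-above (suc m) zero          _               = isEven-suc-double m
isEven-above (suc m) (suc zero)    _               = isEven-double m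
isEven-above (suc m) (suc (suc x)) (s<s (s<s x<)) = isEven-above m x x<

packetOrder-sameLabel : ∀ m x c c′ → x < double m → c ≢ c′ →
                        packetOrder x c c′ ≡ sameLabelAllowed (c <ᵇ c′) (double m ∸ suc x)
packetOrder-sameLabel m x c c′ x< c≢c′ rewrite isEven-above m x x< with isEven x
... | true  = refl
... | false = <ᵇ-flip c c′ c≢c′

sum-allFin : ∀ M (h : ℕ → ℕ) → sum (map (h ∘ toℕ) (allFin M)) ≡ sumˡ M h
sum-allFin M h = sum-tabulate {M} (λ i → i) h (λ i → i) (λ i → refl)
  where
    sum-tabulate : ∀ {M K} (f : Fin M → Fin K) (h t : ℕ → ℕ) → (∀ i → toℕ (f i) ≡ t (toℕ i)) →
                   sum (map (h ∘ toℕ) (tabulate f)) ≡ sumˡ M (h ∘ t)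
    sum-tabulate {zero}  f h t eq = refl
    sum-tabulate {suc M} f h t eq =
      cong₂ _+_ (cong h (eq fzero)) (sum-tabulate (f ∘ fsuc) h (t ∘ suc) (λ i → eq (fsuc i)))

sumˡ-split : ∀ M x s (g : ℕ → ℕ) → x < M →
  sumˡ M (λ j → if (x <ᵇ j) ∨ ((x ≡ᵇ j) ∧ s) then g j else 0)
    ≡ sumˡ M (λ j → if x <ᵇ j then g j else 0) + (if s then g x else 0)
sumˡ-split (suc M) zero    s g _         = +-comm (if s then g 0 else 0) _
sumˡ-split (suc M) (suc x) s g (s<s x<M) = sumˡ-split M x s (g ∘ suc) x<M

sumˡ-reverse : ∀ M (f : ℕ → ℕ) → sumˡ M (λ j → f (M ∸ suc j)) ≡ sumʳ M f
sumˡ-reverse zero    f = refl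
sumˡ-reverse (suc M) f = trans (cong (f M +_) (sumˡ-reverse M f)) (+-comm (f M) _)

sumˡ-reverse-above : ∀ M x (f : ℕ → ℕ) →
  sumˡ M (λ j → if x <ᵇ j then f (M ∸ suc j) else 0) ≡ sumʳ (M ∸ suc x) f
sumˡ-reverse-above zero    x       f = refl
sumˡ-reverse-above (suc M) zero    f = sumˡ-reverse M f
sumˡ-reverse-above (suc M) (suc x) f = sumˡ-reverse-above M x f

consistent-extensions : ∀ m k (cs : List ℕ) → length cs ≡ suc k → Linked _≢_ cs → (x : Fin (double m)) →
  count (λ ls → consistent (x ∷ᵥ ls) cs) (allVecs (double m) k) ≡ extensions (updown cs) (double m ∸ suc (toℕ x))
consistent-extensions m zero    (c ∷ [])      _   [-]             x = refl
consistent-extensions m (suc k) (c ∷ c′ ∷ cs) len (c≢c′ ∷ linked) x = begin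
  count (λ ls → consistent (x ∷ᵥ ls) (c ∷ c′ ∷ cs)) (concatMap (λ y → map (y ∷ᵥ_) (allVecs M k)) (allFin M))
    ≡⟨ count-concatMap _ (λ y → map (y ∷ᵥ_) (allVecs M k)) (allFin M) ⟩
  sum (map (λ y → count (λ ls → consistent (x ∷ᵥ ls) (c ∷ c′ ∷ cs)) (map (y ∷ᵥ_) (allVecs M k))) (allFin M))
    ≡⟨ cong sum (map-cong step (allFin M)) ⟩
  sum (map (term ∘ toℕ) (allFin M))
    ≡⟨ sum-allFin M term ⟩
  sumˡ M term
    ≡⟨ sumˡ-split M (toℕ x) same (λ j → extensions p (M ∸ suc j)) (Fin.toℕ<n x) ⟩
  sumˡ M (λ j → if toℕ x <ᵇ j then extensions p (M ∸ suc j) else 0) + (if same then extensions p above else 0)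
    ≡⟨ cong₂ _+_ (sumˡ-reverse-above M (toℕ x) (extensions p))
                 (cong (λ b → if b then extensions p above else 0) (packetOrder-sameLabel m (toℕ x) c c′ (Fin.toℕ<n x) c≢c′)) ⟩
  extensions (updown (c ∷ c′ ∷ cs)) above ∎
  where
    open ≡-Reasoning
    M = double m
    p = updown (c′ ∷ cs)
    above = M ∸ suc (toℕ x)
    same = packetOrder (toℕ x) c c′
    term : ℕ → ℕ
    term j = if placedAbove (toℕ x) c j c′ then extensions p (M ∸ suc j) else 0
    step : ∀ y → count (λ ls → consistent (x ∷ᵥ ls) (c ∷ c′ ∷ cs)) (map (y ∷ᵥ_) (allVecs M k)) ≡ term (toℕ y)
    step y = begin
      count (λ ls → consistent (x ∷ᵥ ls) (c ∷ c′ ∷ cs)) (map (y ∷ᵥ_) (allVecs M k))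
        ≡⟨ count-map _ (y ∷ᵥ_) (allVecs M k) ⟩
      count (λ ls → placedAbove (toℕ x) c (toℕ y) c′ ∧ consistent (y ∷ᵥ ls) (c′ ∷ cs)) (allVecs M k)
        ≡⟨ count-guarded (placedAbove (toℕ x) c (toℕ y) c′) _ (allVecs M k) ⟩
      (if placedAbove (toℕ x) c (toℕ y) c′ then count (λ ls → consistent (y ∷ᵥ ls) (c′ ∷ cs)) (allVecs M k) else 0)
        ≡⟨ cong (λ n → if placedAbove (toℕ x) c (toℕ y) c′ then n else 0)
                (consistent-extensions m k (c′ ∷ cs) (suc-injective len) linked y) ⟩
      term (toℕ y) ∎

consistent-total : ∀ m k (cs : List ℕ) → length cs ≡ suc k → Linked _≢_ cs →
  count (λ ls → consistent ls cs) (allVecs (double m) (suc k)) ≡ sumʳ (double m) (extensions (updown cs))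
consistent-total m k cs len linked = begin
  count (λ ls → consistent ls cs) (concatMap (λ y → map (y ∷ᵥ_) (allVecs M k)) (allFin M))
    ≡⟨ count-concatMap _ (λ y → map (y ∷ᵥ_) (allVecs M k)) (allFin M) ⟩
  sum (map (λ y → count (λ ls → consistent ls cs) (map (y ∷ᵥ_) (allVecs M k))) (allFin M))
    ≡⟨ cong sum (map-cong
         (λ y → trans (count-map _ (y ∷ᵥ_) (allVecs M k)) (consistent-extensions m k cs len linked y)) (allFin M)) ⟩
  sum (map ((λ j → extensions (updown cs) (M ∸ suc j)) ∘ toℕ) (allFin M)) ≡⟨ sum-allFin M _ ⟩
  sumˡ M (λ j → extensions (updown cs) (M ∸ suc j))                       ≡⟨ sumˡ-reverse M (extensions (updown cs)) ⟩
  sumʳ M (extensions (updown cs))                                         ∎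
  where
    open ≡-Reasoning
    M = double m

placedAbove-cases : ∀ x c y c′ → T (placedAbove x c y c′) → x < y ⊎ (x ≡ y × T (packetOrder x c c′))
placedAbove-cases x c y c′ t with x <ᵇ y in x<ᵇy
... | true = inj₁ (<ᵇ⇒< x y (subst T (sym x<ᵇy) tt))
... | false with x ≡ᵇ y in x≡ᵇy
...   | true  = inj₂ (≡ᵇ⇒≡ x y (subst T (sym x≡ᵇy) tt) , t)
...   | false = ⊥-elim t

placedAbove-< : ∀ x c y c′ → x < y → T (placedAbove x c y c′)
placedAbove-< x c y c′ x<y rewrite T⇒≡true (<⇒<ᵇ x<y) = tt

placedAbove-≡ : ∀ x c c′ → T (packetOrder x c c′) → T (placedAbove x c x c′)
placedAbove-≡ x c c′ o rewrite ¬T⇒≡false {x <ᵇ x} (λ t → <-irrefl refl (<ᵇ⇒< x x t)) | T⇒≡true (≡⇒≡ᵇ x x refl) = o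

packetOrder-trans : ∀ x c c′ c″ → T (packetOrder x c c′) → T (packetOrder x c′ c″) → T (packetOrder x c c″)
packetOrder-trans x c c′ c″ o₁ o₂ with isEven x
... | true  = <⇒<ᵇ (<-trans (<ᵇ⇒< c c′ o₁) (<ᵇ⇒< c′ c″ o₂))
... | false = <⇒<ᵇ (<-trans (<ᵇ⇒< c″ c′ o₂) (<ᵇ⇒< c′ c o₁))

packetOrder-asym : ∀ x c c′ → T (packetOrder x c c′) → T (packetOrder x c′ c) → ⊥
packetOrder-asym x c c′ o₁ o₂ with isEven x
... | true  = <-asym (<ᵇ⇒< c c′ o₁) (<ᵇ⇒< c′ c o₂)
... | false = <-asym (<ᵇ⇒< c′ c o₁) (<ᵇ⇒< c c′ o₂)

placedAbove-trans : ∀ x c y c′ z c″ → T (placedAbove x c y c′) → T (placedAbove y c′ z c″) → T (placedAbove x c z c″)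
placedAbove-trans x c y c′ z c″ t₁ t₂ with placedAbove-cases x c y c′ t₁ | placedAbove-cases y c′ z c″ t₂
... | inj₁ x<y          | inj₁ y<z          = placedAbove-< x c z c″ (<-trans x<y y<z)
... | inj₁ x<y          | inj₂ (refl , _)   = placedAbove-< x c z c″ x<y
... | inj₂ (refl , _)   | inj₁ y<z          = placedAbove-< x c z c″ y<z
... | inj₂ (refl , o₁)  | inj₂ (refl , o₂)  = placedAbove-≡ x c c″ (packetOrder-trans x c c′ c″ o₁ o₂)

placedAbove-asym : ∀ x c y c′ → T (placedAbove x c y c′) → T (placedAbove y c′ x c) → ⊥
placedAbove-asym x c y c′ t₁ t₂ with placedAbove-cases x c y c′ t₁ | placedAbove-cases y c′ x c t₂
... | inj₁ x<y         | inj₁ y<x        = <-asym x<y y<x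
... | inj₁ x<y         | inj₂ (y≡x , _)  = <-irrefl (sym y≡x) x<y
... | inj₂ (x≡y , _)   | inj₁ y<x        = <-irrefl (sym x≡y) y<x
... | inj₂ (refl , o₁) | inj₂ (_ , o₂)   = packetOrder-asym x c c′ o₁ o₂

module _ {A : Set} {R : A → A → Set} (irrefl : ∀ {a} → R a a → ⊥) (asym : ∀ {a b} → R a b → R b a → ⊥) where

  private
    drop-head : ∀ {x xs ys} → All (R x) xs → (∀ {z} → z ∈ x ∷ xs → z ∈ x ∷ ys) → ∀ {z} → z ∈ xs → z ∈ ys
    drop-head px sub z∈xs with sub (there z∈xs)
    ... | here refl = ⊥-elim (irrefl (All.lookup px z∈xs))
    ... | there z∈ys = z∈ys

  sorted-unique : ∀ {xs ys} → AllPairs R xs → AllPairs R ys →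
                  (∀ {z} → z ∈ xs → z ∈ ys) → (∀ {z} → z ∈ ys → z ∈ xs) → xs ≡ ys
  sorted-unique {[]}     {[]}     _ _ _ _ = refl
  sorted-unique {[]}     {y ∷ ys} _ _ _ ⊇ with ⊇ (here refl)
  ... | ()
  sorted-unique {x ∷ xs} {[]}     _ _ ⊆ _ with ⊆ (here refl)
  ... | ()
  sorted-unique {x ∷ xs} {y ∷ ys} (px ∷ sxs) (py ∷ sys) ⊆ ⊇ with ⊆ (here refl) | ⊇ (here refl)
  ... | there x∈ys | there y∈xs = ⊥-elim (asym (All.lookup px y∈xs) (All.lookup py x∈ys))
  ... | here refl  | _          = cong (x ∷_) (sorted-unique sxs sys (drop-head px ⊆) (drop-head py ⊇))
  ... | there _    | here refl  = cong (x ∷_) (sorted-unique sxs sys (drop-head px ⊆) (drop-head py ⊇))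

AllPairs-reverse : {A : Set} {R : A → A → Set} {xs : List A} → AllPairs (λ a b → R b a) xs → AllPairs R (reverse xs)
AllPairs-reverse {xs = []}     []          = []
AllPairs-reverse {xs = x ∷ xs} (px ∷ pxs) rewrite unfold-reverse x xs =
  AllPairsₚ.++⁺ (AllPairs-reverse pxs) ([] ∷ []) (All.tabulate (λ y∈ → All.lookup px (Anyₚ.reverse⁻ y∈) ∷ []))

AllPairs-restrict : {A : Set} {R S : A → A → Set} {P : A → Set} {xs : List A} → AllPairs R xs → All P xs →
                    (∀ {a b} → P a → P b → R a b → S a b) → AllPairs S xs
AllPairs-restrict []         []         h = []
AllPairs-restrict (rx ∷ rxs) (px ∷ pxs) h =
  All.zipWith (λ (pb , rb) → h px pb rb) (pxs , rx) ∷ AllPairs-restrict rxs pxs h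

isEven-%2 : ∀ x → isEven x ≡ (x % 2 ≡ᵇ 0)
isEven-%2 zero          = refl
isEven-%2 (suc zero)    = refl
isEven-%2 (suc (suc x)) = trans (isEven-%2 x) (cong (_≡ᵇ 0) (sym (trans (cong (_% 2) (+-comm 2 x)) ([m+n]%n≡m%n x 2))))

packetOrder-increasing : ∀ x c c′ → isEven x ≡ true → c < c′ → T (packetOrder x c c′)
packetOrder-increasing x c c′ even c<c′ rewrite even = <⇒<ᵇ c<c′

packetOrder-decreasing : ∀ x c c′ → isEven x ≡ false → c′ < c → T (packetOrder x c c′)
packetOrder-decreasing x c c′ odd c′<c rewrite odd = <⇒<ᵇ c′<c

Above : ∀ {K n} → Vec (Fin K) n → Fin n → Fin n → Set
Above f a b = T (placedAbove (toℕ (lookup f a)) (toℕ a) (toℕ (lookup f b)) (toℕ b))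

Above-asym : ∀ {K n} (f : Vec (Fin K) n) {a b} → Above f a b → Above f b a → ⊥
Above-asym f {a} {b} = placedAbove-asym (toℕ (lookup f a)) (toℕ a) (toℕ (lookup f b)) (toℕ b)

Above-irrefl : ∀ {K n} (f : Vec (Fin K) n) {a} → Above f a a → ⊥
Above-irrefl f t = Above-asym f t t

Above-trans : ∀ {K n} (f : Vec (Fin K) n) {a b c} → Above f a b → Above f b c → Above f a c
Above-trans f {a} {b} {c} =
  placedAbove-trans (toℕ (lookup f a)) (toℕ a) (toℕ (lookup f b)) (toℕ b) (toℕ (lookup f c)) (toℕ c)

module ShuffledDeck (m n : ℕ) (f : Vec (Fin (2 * m)) n) where

  private
    block : Fin (2 * m) → List (Fin n)
    block j = if toℕ j % 2 ≡ᵇ 0 then packet f j else reverse (packet f j)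

    packet-label : ∀ j {a} → a ∈ packet f j → lookup f a ≡ j
    packet-label j a∈ = proj₂ (∈-filter⁻ (λ i → lookup f i Fin.≟ j) {xs = allFin n} a∈)

    block-label : ∀ j {a} → a ∈ block j → lookup f a ≡ j
    block-label j a∈ with toℕ j % 2 ≡ᵇ 0
    ... | true  = packet-label j a∈
    ... | false = packet-label j (Anyₚ.reverse⁻ a∈)

    allFin-sorted : ∀ K → AllPairs (λ (i j : Fin K) → toℕ i < toℕ j) (allFin K)
    allFin-sorted K = AllPairsₚ.tabulate⁺-< (λ i<j → i<j)

    packet-sorted : ∀ j → AllPairs (λ a b → toℕ a < toℕ b) (packet f j)
    packet-sorted j = AllPairsₚ.filter⁺ (λ i → lookup f i Fin.≟ j) (allFin-sorted n)

    within : ∀ j {a b} → lookup f a ≡ j → lookup f b ≡ j → T (packetOrder (toℕ j) (toℕ a) (toℕ b)) → Above f a b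
    within j {a} {b} fa≡j fb≡j o = subst₂ (λ u v → T (placedAbove (toℕ u) (toℕ a) (toℕ v) (toℕ b)))
      (sym fa≡j) (sym fb≡j) (placedAbove-≡ (toℕ j) (toℕ a) (toℕ b) o)

    block-sorted : ∀ j → AllPairs (Above f) (block j)
    block-sorted j with toℕ j % 2 ≡ᵇ 0 in parity
    ... | true  = AllPairs-restrict (packet-sorted j) (All.tabulate (packet-label j))
      (λ {a} {b} a∈ b∈ a<b → within j a∈ b∈ (packetOrder-increasing (toℕ j) (toℕ a) (toℕ b) even a<b))
      where
        even : isEven (toℕ j) ≡ true
        even = trans (isEven-%2 (toℕ j)) parity
    ... | false = AllPairs-reverse (AllPairs-restrict (packet-sorted j) (All.tabulate (packet-label j))
      (λ {a} {b} a∈ b∈ a<b → within j b∈ a∈ (packetOrder-decreasing (toℕ j) (toℕ b) (toℕ a) odd a<b)))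
      where
        odd : isEven (toℕ j) ≡ false
        odd = trans (isEven-%2 (toℕ j)) parity

  deck-sorted : AllPairs (Above f) (shelfDeck m n f)
  deck-sorted = AllPairsₚ.concat⁺ (Allₚ.map⁺ (Allₚ.tabulate⁺ block-sorted))
    (AllPairsₚ.map⁺ (AllPairs.map across (allFin-sorted (2 * m))))
    where
      across : ∀ {j j′} → toℕ j < toℕ j′ → All (λ a → All (Above f a) (block j′)) (block j)
      across j<j′ = All.tabulate (λ {a} a∈ → All.tabulate (λ {b} b∈ →
        placedAbove-< (toℕ (lookup f a)) (toℕ a) (toℕ (lookup f b)) (toℕ b)
          (subst₂ (λ u v → toℕ u < toℕ v) (sym (block-label _ a∈)) (sym (block-label _ b∈)) j<j′)))

  deck-complete : ∀ c → c ∈ shelfDeck m n f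
  deck-complete c = ∈-concatMap⁺ block (lose (∈-allFin (lookup f c)) in-block)
    where
      in-block : c ∈ block (lookup f c)
      in-block with toℕ (lookup f c) % 2 ≡ᵇ 0
      ... | true  = ∈-filter⁺ (λ i → lookup f i Fin.≟ lookup f c) (∈-allFin c) refl
      ... | false = Anyₚ.reverse⁺ (∈-filter⁺ (λ i → lookup f i Fin.≟ lookup f c) (∈-allFin c) refl)

chainedAbove : ∀ {K n} → Vec (Fin K) n → List (Fin n) → Bool
chainedAbove f (a ∷ b ∷ ws) = placedAbove (toℕ (lookup f a)) (toℕ a) (toℕ (lookup f b)) (toℕ b) ∧ chainedAbove f (b ∷ ws)
chainedAbove f _            = true

chainedAbove⇒Linked : ∀ {K n} (f : Vec (Fin K) n) ws → T (chainedAbove f ws) → Linked (Above f) ws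
chainedAbove⇒Linked f []           _ = []
chainedAbove⇒Linked f (a ∷ [])     _ = [-]
chainedAbove⇒Linked f (a ∷ b ∷ ws) t = proj₁ (T-∧ .to t) ∷ chainedAbove⇒Linked f (b ∷ ws) (proj₂ (T-∧ .to t))
  where open Equivalence

Linked⇒chainedAbove : ∀ {K n} (f : Vec (Fin K) n) {ws} → Linked (Above f) ws → T (chainedAbove f ws)
Linked⇒chainedAbove f []         = tt
Linked⇒chainedAbove f [-]        = tt
Linked⇒chainedAbove f (ab ∷ abs) = T-∧ .from (ab , Linked⇒chainedAbove f abs)
  where open Equivalence

shelfDeck≟ : ∀ m n (f : Vec (Fin (2 * m)) n) ws → (∀ c → c ∈ ws) →
             does (≡-dec Fin._≟_ (shelfDeck m n f) ws) ≡ chainedAbove f ws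
shelfDeck≟ m n f ws all∈ with ≡-dec Fin._≟_ (shelfDeck m n f) ws
... | yes deck≡ws = sym (T⇒≡true (Linked⇒chainedAbove f
                      (subst (Linked (Above f)) deck≡ws (Linkedₚ.AllPairs⇒Linked deck-sorted))))
  where open ShuffledDeck m n f
... | no  deck≢ws = sym (¬T⇒≡false (λ t → deck≢ws
                      (sorted-unique (Above-irrefl f) (Above-asym f) deck-sorted
                        (Linkedₚ.Linked⇒AllPairs (Above-trans f) (chainedAbove⇒Linked f ws t))
                        (λ {z} _ → all∈ z) (λ {z} _ → deck-complete z))))
  where open ShuffledDeck m n f

chainedAbove-tabulate : ∀ {K n k} (f : Vec (Fin K) n) (g : Fin k → Fin n) →
  consistent (Vec.tabulate (lookup f ∘ g)) (map toℕ (tabulate g)) ≡ chainedAbove f (tabulate g)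
chainedAbove-tabulate {k = zero}        f g = refl
chainedAbove-tabulate {k = suc zero}    f g = refl
chainedAbove-tabulate {k = suc (suc k)} f g =
  cong (placedAbove (toℕ (lookup f a)) (toℕ a) (toℕ (lookup f b)) (toℕ b) ∧_) (chainedAbove-tabulate f (g ∘ fsuc))
  where
    a = g fzero
    b = g (fsuc fzero)

allVecs-cartesian : ∀ {K n} (xs : List (Fin K)) (ys : List (Vec (Fin K) n)) →
                    concatMap (λ x → map (x ∷ᵥ_) ys) xs ≡ cartesianProductWith _∷ᵥ_ xs ys
allVecs-cartesian []       ys = refl
allVecs-cartesian (x ∷ xs) ys = cong (map (x ∷ᵥ_) ys ++_) (allVecs-cartesian xs ys)

allVecs-unique : ∀ K n → Unique (allVecs K n)
allVecs-unique K zero    = [] ∷ []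
allVecs-unique K (suc n) = subst Unique (sym (allVecs-cartesian (allFin K) (allVecs K n)))
  (Uniqueₚ.cartesianProductWith⁺ _∷ᵥ_ Vecₚ.∷-injective (Uniqueₚ.tabulate⁺ (λ e → e)) (allVecs-unique K n))

allVecs-complete : ∀ K n (v : Vec (Fin K) n) → v ∈ allVecs K n
allVecs-complete K zero    []ᵥ      = here refl
allVecs-complete K (suc n) (x ∷ᵥ v) = subst ((x ∷ᵥ v) ∈_) (sym (allVecs-cartesian (allFin K) (allVecs K n)))
  (∈-cartesianProductWith⁺ _∷ᵥ_ (∈-allFin x) (allVecs-complete K n v))

count-bijection : ∀ K n (φ ψ : Vec (Fin K) n → Vec (Fin K) n) → (∀ v → φ (ψ v) ≡ v) → (∀ v → ψ (φ v) ≡ v) →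
                  (q : Vec (Fin K) n → Bool) → count (q ∘ φ) (allVecs K n) ≡ count q (allVecs K n)
count-bijection K n φ ψ φψ ψφ q = trans (sym (count-map q φ (allVecs K n))) (count-↭ q φ[all]↭all)
  where
    φ-injective : ∀ {u v} → φ u ≡ φ v → u ≡ v
    φ-injective {u} {v} φu≡φv = trans (sym (ψφ u)) (trans (cong ψ φu≡φv) (ψφ v))
    φ[all]↭all : map φ (allVecs K n) ↭ allVecs K n
    φ[all]↭all = ∼bag⇒↭ (unique∧set⇒bag (Uniqueₚ.map⁺ φ-injective (allVecs-unique K n)) (allVecs-unique K n)
      (λ {v} → mk⇔ (λ _ → allVecs-complete K n v)
                   (λ _ → subst (_∈ map φ (allVecs K n)) (φψ v) (∈-map⁺ φ (allVecs-complete K n (ψ v))))))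

module Relabel {n : ℕ} (K : ℕ) (w : Permutation′ n) where

  alongPositions : Vec (Fin K) n → Vec (Fin K) n
  alongPositions f = Vec.tabulate (λ i → lookup f (w ⟨$⟩ʳ i))

  alongCards : Vec (Fin K) n → Vec (Fin K) n
  alongCards ls = Vec.tabulate (λ c → lookup ls (w ⟨$⟩ˡ c))

  positions-cards : ∀ ls → alongPositions (alongCards ls) ≡ ls
  positions-cards ls = trans (Vecₚ.tabulate-cong (λ i → trans (Vecₚ.lookup∘tabulate _ (w ⟨$⟩ʳ i))
    (cong (lookup ls) (inverseˡ w)))) (Vecₚ.tabulate∘lookup ls)

  cards-positions : ∀ f → alongCards (alongPositions f) ≡ f
  cards-positions f = trans (Vecₚ.tabulate-cong (λ c → trans (Vecₚ.lookup∘tabulate _ (w ⟨$⟩ˡ c))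
    (cong (lookup f) (inverseʳ w)))) (Vecₚ.tabulate∘lookup f)

valleys-updown : ∀ cs → Linked _≢_ cs → valleysList cs ≡ valleysOf (updown cs)
valleys-updown []                 _                    = refl
valleys-updown (a ∷ [])           _                    = refl
valleys-updown (a ∷ b ∷ [])       _                    with a <ᵇ b
... | true  = refl
... | false = refl
valleys-updown (a ∷ b ∷ c ∷ cs)   (a≢b ∷ linked)       = step (valleys-updown (b ∷ c ∷ cs) linked)
  where
    step : valleysList (b ∷ c ∷ cs) ≡ valleysOf (updown (b ∷ c ∷ cs)) →
           valleysList (a ∷ b ∷ c ∷ cs) ≡ valleysOf (updown (a ∷ b ∷ c ∷ cs))
    step ih rewrite <ᵇ-flip a b a≢b with a <ᵇ b
    ... | true  = ih
    ... | false with b <ᵇ c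
    ...   | true  = cong suc ih
    ...   | false = ih

length-updown : ∀ c cs → length (c ∷ cs) ≡ suc (length (updown (c ∷ cs)))
length-updown c []        = refl
length-updown c (c′ ∷ cs) = cong suc (length-updown c′ cs)

permList-linked : ∀ {n} (w : Permutation′ n) → Linked _≢_ (map toℕ (permList w))
permList-linked w = tabulate-linked (w ⟨$⟩ʳ_) (λ {i} {j} e → trans (sym (inverseˡ w)) (trans (cong (w ⟨$⟩ˡ_) e) (inverseˡ w)))
  where
    tabulate-linked : ∀ {n k} (g : Fin k → Fin n) → (∀ {i j} → g i ≡ g j → i ≡ j) → Linked _≢_ (map toℕ (tabulate g))
    tabulate-linked {k = zero}        g injective = []
    tabulate-linked {k = suc zero}    g injective = [-]
    tabulate-linked {k = suc (suc k)} g injective =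
      (λ e → 0≢1 (injective (Fin.toℕ-injective e))) ∷ tabulate-linked (g ∘ fsuc) (Fin.suc-injective ∘ injective)
      where
        0≢1 : fzero {suc k} ≢ fsuc fzero
        0≢1 ()

permList-complete : ∀ {n} (w : Permutation′ n) c → c ∈ permList w
permList-complete w c = subst (_∈ permList w) (inverseʳ w) (∈-tabulate⁺ (w ⟨$⟩ˡ c))

length-permList : ∀ {n} (w : Permutation′ n) → length (map toℕ (permList w)) ≡ n
length-permList w = trans (length-map toℕ (permList w)) (length-tabulate (w ⟨$⟩ʳ_))

double≡2* : ∀ m → 2 * m ≡ double m
double≡2* zero    = refl
double≡2* (suc m) = cong suc (trans (+-suc m (m + 0)) (cong suc (double≡2* m)))

shelfCount-extensions : ∀ m k (w : Permutation′ (suc k)) →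
  shelfCount m (suc k) w ≡ sumʳ (double m) (extensions (updown (map toℕ (permList w))))
shelfCount-extensions m k w = begin
  shelfCount m n w
    ≡⟨ length-filter (λ f → ≡-dec Fin._≟_ (shelfDeck m n f) ws) (allVecs (2 * m) n) ⟩
  count (λ f → does (≡-dec Fin._≟_ (shelfDeck m n f) ws)) (allVecs (2 * m) n)
    ≡⟨ count-cong (allVecs (2 * m) n) (λ f → trans (shelfDeck≟ m n f ws (permList-complete w))
                                                   (sym (chainedAbove-tabulate f (w ⟨$⟩ʳ_)))) ⟩
  count ((λ ls → consistent ls cs) ∘ alongPositions) (allVecs (2 * m) n)
    ≡⟨ count-bijection (2 * m) n alongPositions alongCards positions-cards cards-positions (λ ls → consistent ls cs) ⟩
  count (λ ls → consistent ls cs) (allVecs (2 * m) n)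
    ≡⟨ cong (λ K → count (λ (ls : Vec (Fin K) n) → consistent ls cs) (allVecs K n)) (double≡2* m) ⟩
  count (λ ls → consistent ls cs) (allVecs (double m) n)
    ≡⟨ consistent-total m k cs (length-permList w) (permList-linked w) ⟩
  sumʳ (double m) (extensions (updown cs)) ∎
  where
    open ≡-Reasoning
    open Relabel (2 * m) w
    n = suc k
    ws = permList w
    cs = map toℕ ws

sum-upTo : ∀ (F : ℕ → ℕ) k → sum (map F (upTo k)) ≡ sumˡ k F
sum-upTo F k = sum-applyUpTo (λ a → a) k
  where
    sum-applyUpTo : ∀ h k → sum (map F (applyUpTo h k)) ≡ sumˡ k (F ∘ h)
    sum-applyUpTo h zero    = refl
    sum-applyUpTo h (suc k) = cong (F (h 0) +_) (sum-applyUpTo (h ∘ suc) k)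

-- Imported only here: the prefix operator +_ would make the sections (x +_) above ambiguous.
open import Data.Integer using (+_; _-_; _⊖_)
import Data.Integer as ℤ
import Data.Integer.Properties as ℤ

first-argument : ∀ N m′ a → a ≤ m′ → (+ (N + suc m′) - + a) - + 1 ≡ + ((m′ ∸ a) + N)
first-argument N m′ a a≤m′ = begin
  (+ (N + suc m′) - + a) - + 1 ≡⟨ cong (_- + 1) (trans (ℤ.[+m]-[+n]≡m⊖n (N + suc m′) a) (ℤ.⊖-≥ a≤N+m′)) ⟩
  + (N + suc m′ ∸ a) - + 1     ≡⟨ cong (λ z → + z - + 1) difference ⟩
  + suc (m′ ∸ a + N) - + 1     ≡⟨ ℤ.[+m]-[+n]≡m⊖n (suc (m′ ∸ a + N)) 1 ⟩
  + (m′ ∸ a + N)               ∎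
  where
    open ≡-Reasoning
    a≤N+m′ : a ≤ N + suc m′
    a≤N+m′ = ≤-trans a≤m′ (≤-trans (n≤1+n m′) (m≤n+m (suc m′) N))
    difference : N + suc m′ ∸ a ≡ suc (m′ ∸ a + N)
    difference = begin
      N + suc m′ ∸ a             ≡⟨ cong (λ z → N + suc z ∸ a) (sym (m+[n∸m]≡n a≤m′)) ⟩
      N + suc (a + (m′ ∸ a)) ∸ a
        ≡⟨ cong (_∸ a) (solve 3 (λ n a d → n :+ (con 1 :+ (a :+ d)) := a :+ (con 1 :+ (d :+ n))) refl N a (m′ ∸ a)) ⟩
      a + suc (m′ ∸ a + N) ∸ a   ≡⟨ m+n∸m≡n a _ ⟩
      suc (m′ ∸ a + N)           ∎

second-argument : ∀ e v → (+ suc (e + 2 * v) - + 1) - + (2 * v) ≡ + e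
second-argument e v = begin
  (+ suc (e + 2 * v) - + 1) - + (2 * v) ≡⟨ cong (_- + (2 * v)) (ℤ.[+m]-[+n]≡m⊖n (suc (e + 2 * v)) 1) ⟩
  + (e + 2 * v) - + (2 * v)             ≡⟨ ℤ.[+m]-[+n]≡m⊖n (e + 2 * v) (2 * v) ⟩
  (e + 2 * v) ⊖ (2 * v)                 ≡⟨ ℤ.⊖-≥ (m≤n+m (2 * v) e) ⟩
  + (e + 2 * v ∸ 2 * v)                 ≡⟨ cong +_ (m+n∸n≡m e (2 * v)) ⟩
  + e                                   ∎
  where open ≡-Reasoning

binomℤ-shifted : ∀ e v a → binomℤ (+ e) (+ a - + v) ≡ (if a <ᵇ v then 0 else e C (a ∸ v))
binomℤ-shifted e v a with a <? v
... | yes a<v = begin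
  binomℤ (+ e) (+ a - + v)          ≡⟨ cong (binomℤ (+ e)) (trans (ℤ.[+m]-[+n]≡m⊖n a v) (ℤ.⊖-< a<v)) ⟩
  binomℤ (+ e) (ℤ.- (+ (v ∸ a)))    ≡⟨ negative (v ∸ a) (m>n⇒m∸n≢0 a<v) ⟩
  0                                 ≡⟨ cong (λ b → if b then 0 else e C (a ∸ v)) (sym (T⇒≡true (<⇒<ᵇ a<v))) ⟩
  (if a <ᵇ v then 0 else e C (a ∸ v)) ∎
  where
    open ≡-Reasoning
    negative : ∀ d → d ≢ 0 → binomℤ (+ e) (ℤ.- (+ d)) ≡ 0
    negative zero    d≢0 = ⊥-elim (d≢0 refl)
    negative (suc d) _   = refl
... | no a≮v = begin
  binomℤ (+ e) (+ a - + v)          ≡⟨ cong (binomℤ (+ e)) (trans (ℤ.[+m]-[+n]≡m⊖n a v) (ℤ.⊖-≥ (≮⇒≥ a≮v))) ⟩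
  e C (a ∸ v)                       ≡⟨ cong (λ b → if b then 0 else e C (a ∸ v)) (sym (¬T⇒≡false (λ t → a≮v (<ᵇ⇒< a v t)))) ⟩
  (if a <ᵇ v then 0 else e C (a ∸ v)) ∎
  where open ≡-Reasoning

binomialSum : ∀ p m′ N v → N ≡ suc (length p) → v ≡ valleysOf p →
  2 * sumʳ (double (suc m′)) (extensions p)
    ≡ 4 ^ (v + 1) * sum (map (λ a → binomℤ (+ (N + suc m′) - + a - + 1) (+ N)
                                    * binomℤ (+ N - + 1 - + (2 * v)) (+ a - + v))
                             (upTo (suc m′)))
binomialSum p m′ _ _ refl refl = begin
  2 * sumʳ (double (suc m′)) (extensions p)     ≡⟨ cong (2 *_) (totalExtensions p m′) ⟩
  2 * (2 * 4 ^ v * sumˡ (suc m′) G)             ≡⟨ solve 2 (λ x y → con 2 :* ((con 2 :* x) :* y) := (x :* con 4) :* y) refl (4 ^ v) _ ⟩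
  4 ^ v * 4 * sumˡ (suc m′) G                   ≡⟨ cong (_* sumˡ (suc m′) G) (sym (^-distribˡ-+-* 4 v 1)) ⟩
  4 ^ (v + 1) * sumˡ (suc m′) G                 ≡⟨ cong (4 ^ (v + 1) *_) (sumˡ-cong (suc m′) (λ a a≤m′ → sym (term a (≤-pred a≤m′)))) ⟩
  4 ^ (v + 1) * sumˡ (suc m′) F                 ≡⟨ cong (4 ^ (v + 1) *_) (sym (sum-upTo F (suc m′))) ⟩
  4 ^ (v + 1) * sum (map F (upTo (suc m′)))     ∎
  where
    open ≡-Reasoning
    v = valleysOf p
    e = freeSteps p
    N = suc (length p)
    G F : ℕ → ℕ
    G a = (((m′ ∸ a) + N) C N) * (if a <ᵇ v then 0 else e C (a ∸ v))
    F a = binomℤ (+ (N + suc m′) - + a - + 1) (+ N) * binomℤ (+ N - + 1 - + (2 * v)) (+ a - + v)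
    term : ∀ a → a ≤ m′ → F a ≡ G a
    term a a≤m′ = cong₂ _*_ (cong (λ z → binomℤ z (+ N)) (first-argument N m′ a a≤m′))
      (trans (cong (λ z → binomℤ z (+ a - + v)) (trans (cong (λ z → + suc z - + 1 - + (2 * v)) (length-pattern p))
                                                       (second-argument e v)))
             (binomℤ-shifted e v a))

theorem3p1 : (n m : ℕ) → n ≥ 1 → m ≥ 1 → (w : Permutation′ n) →
    2 * shelfCount m n w
      ≡ 4 ^ (valleys w + 1)
        * sum (map (λ a → binomℤ (+ (n + m) - + a - + 1) (+ n)
                          * binomℤ (+ n - + 1 - + (2 * valleys w)) (+ a - + valleys w))
                   (upTo m))
theorem3p1 (suc k) (suc m′) _ _ w =
  trans (cong (2 *_) (shelfCount-extensions (suc m′) k w))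
        (binomialSum (updown cs) m′ (suc k) (valleys w) cards (valleys-updown cs (permList-linked w)))
  where
    cs = map toℕ (permList w)
    cards : suc k ≡ suc (length (updown cs))
    cards = trans (sym (length-permList w))
                  (length-updown (toℕ (w ⟨$⟩ʳ fzero)) (map toℕ (tabulate (λ i → w ⟨$⟩ʳ fsuc i))))
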